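{- Let $K$ be a polyhedral complex with a monotonic ordering $\sigma_0, \ldots, \sigma_m$ of its cells, let $\partial$ be its boundary matrix, and let $R = \partial U$ and $Q = V\partial$ be the matrix equations obtained after the exhaustive column reduction and exhaustive row reduction algorithms, respectively. Let $K^p = A_p \sqcup A^p \sqcup E_p$ be the tri-partition associated with this ordering. Then for every $i \neq j$ there is a dimension $q$ such that $U[i,j]=1$ implies $\sigma_i \in A_q$, and $V[i,j]=1$ implies $\sigma_j \in A^q$.
   Context: A polyhedral complex $K$ is a finite collection of convex polytopes (cells), closed under taking faces, any two intersecting in a common face, and containing by convention the empty cell (dimension $-1$, a face of every cell). $K^p$ is the set of $p$-cells. A monotonic ordering $\sigma_0, \ldots, \sigma_m$ of all cells of $K$ is one in which every cell is preceded by all its faces. The boundary matrix $\partial[0..m,0..m]$ over $\mathbb{Z}/2\mathbb{Z}$ has $\partial[i,j]=1$ iff $\sigma_i \subseteq \sigma_j$ and $\dim\sigma_i = \dim\sigma_j - 1$, and $0$ otherwise. Exhaustive column reduction: initialize $R=\partial$, $U=\mathrm{Id}$; writing $\mathrm{low}(j)$ for the row index of the lowest non-zero entry of column $j$ of $R$ ($-\infty$ if the column is zero), for $j=0$ to $m$: while there exists $\ell<j$ with $\mathrm{low}(\ell)>-\infty$ and $R[\mathrm{low}(\ell),j]\neq 0$, add column $\ell$ to column $j$ in both $R$ and $U$ (mod 2). Exhaustive row reduction: initialize $Q=\partial$, $V=\mathrm{Id}$; writing $\mathrm{left}(i)$ for the column index of the leftmost non-zero entry of row $i$ of $Q$ ($\infty$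 if zero), for $i=m$ down to $0$: while there exists $\ell>i$ with $\mathrm{left}(\ell)<\infty$ and $Q[i,\mathrm{left}(\ell)]\neq 0$, add row $\ell$ to row $i$ in both $Q$ and $V$ (mod 2). The tri-partition associated with the ordering is: $A_p$ = the $p$-cells $\sigma_j$ whose column $j$ of $R$ is non-zero after exhaustive column reduction; $A^p$ = the $p$-cells $\sigma_i$ whose row $i$ of $Q$ is non-zero after exhaustive row reduction; $E_p = K^p\setminus A_p\setminus A^p$. -}

module Defs where

open import Data.Nat using (ℕ; zero; suc; _+_)
open import Data.Fin using (Fin; toℕ; _≟_; _<_; _≤_)
open import Data.Integer as ℤ using (ℤ; -[1+_])
open import Data.Bool using (Bool; true; false; if_then_else_; _xor_; _∧_)
open import Data.Product using (Σ; _×_; _,_; proj₁; proj₂; ∃)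
open import Relation.Nullary using (Dec; ¬_; yes; no)
open import Relation.Nullary.Decidable using (⌊_⌋)
open import Relation.Binary.PropositionalEquality using (_≡_; _≢_)
open import Relation.Binary.Construct.Closure.ReflexiveTransitive using (Star)

-- Polyhedral complexes, through their face poset.
-- The n cells are indexed by Fin n in the given ordering σ₀,…,σₘ
-- (n = m+1).  i ≼ j means σ_i ⊆ σ_j (σ_i is a face of σ_j).
-- The empty cell (dimension -1) is included.

record PolyhedralComplex (n : ℕ) : Set₁ where
  field
    _≼_      : Fin n → Fin n → Set
    _≼?_     : (i j : Fin n) → Dec (i ≼ j)
    dim      : Fin n → ℤ
    ≼-refl   : ∀ i → i ≼ i
    ≼-trans  : ∀ {i j k} → i ≼ j → j ≼ k → i ≼ k
    ≼-antisym : ∀ {i j} → i ≼ j → j ≼ i → i ≡ j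
    dim-mono : ∀ {i j} → i ≼ j → i ≢ j → dim i ℤ.< dim j
    empty    : Fin n
    dim-empty : dim empty ≡ -[1+ 0 ]
    empty-face : ∀ i → empty ≼ i
    dim≥-1   : ∀ i → -[1+ 0 ] ℤ.≤ dim i

Monotonic : ∀ {n} → PolyhedralComplex n → Set
Monotonic {n} K = ∀ (i j : Fin n) → PolyhedralComplex._≼_ K i j → i ≤ j

-- Matrices over ℤ/2ℤ (Bool, addition = xor)

Mat : ℕ → Set
Mat n = Fin n → Fin n → Bool      -- M r c = entry in row r, column c

Id : ∀ {n} → Mat n
Id r c = ⌊ r ≟ c ⌋

boundary : ∀ {n} → PolyhedralComplex n → Mat n
boundary K i j = ⌊ i ≼? j ⌋ ∧ ⌊ dim i ℤ.+ ℤ.+ 1 ℤ.≟ dim j ⌋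
  where open PolyhedralComplex K

addCol : ∀ {n} → Fin n → Fin n → Mat n → Mat n
addCol ℓ j M r c = if ⌊ c ≟ j ⌋ then M r c xor M r ℓ else M r c

addRow : ∀ {n} → Fin n → Fin n → Mat n → Mat n
addRow ℓ i M r c = if ⌊ r ≟ i ⌋ then M r c xor M ℓ c else M r c

-- low(j) = r : r is the lowest (largest) row index with a nonzero entry in column j
-- (low(j) > -∞ iff some such r exists)
Low : ∀ {n} → Mat n → Fin n → Fin n → Set
Low M j r = M r j ≡ true × (∀ r' → M r' j ≡ true → r' ≤ r)

Left : ∀ {n} → Mat n → Fin n → Fin n → Set
Left M i c = M i c ≡ true × (∀ c' → M i c' ≡ true → c ≤ c')

State : ℕ → Set
State n = Mat n × Mat n

-- Exhaustive column reduction (R, U), any order of choices.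

ColPivotable : ∀ {n} → Mat n → Fin n → Fin n → Set
ColPivotable R j ℓ = ℓ < j × ∃ λ r → Low R ℓ r × R r j ≡ true

data ColStep {n} (j : Fin n) : State n → State n → Set where
  step : ∀ {R U} ℓ → ColPivotable R j ℓ →
         ColStep j (R , U) (addCol ℓ j R , addCol ℓ j U)

ColDone : ∀ {n} → Fin n → State n → Set
ColDone j s = ∀ ℓ → ¬ ColPivotable (proj₁ s) j ℓ

-- ColRuns k s s' : starting from s, columns 0,…,k-1 have been processed
-- (in this order), each until its while loop terminates, reaching s'.
data ColRuns {n} : ℕ → State n → State n → Set where
  start : ∀ {s} → ColRuns 0 s s
  next  : ∀ {k s s' s''} → ColRuns k s s' → (j : Fin n) → toℕ j ≡ k →
          Star (ColStep j) s' s'' → ColDone j s'' → ColRuns (suc k) s s''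

ExhaustiveColumnReduction : ∀ {n} → PolyhedralComplex n → Mat n → Mat n → Set
ExhaustiveColumnReduction {n} K R U = ColRuns n (boundary K , Id) (R , U)

-- Exhaustive row reduction (Q, V), any order of choices.

RowPivotable : ∀ {n} → Mat n → Fin n → Fin n → Set
RowPivotable Q i ℓ = i < ℓ × ∃ λ c → Left Q ℓ c × Q i c ≡ true

data RowStep {n} (i : Fin n) : State n → State n → Set where
  step : ∀ {Q V} ℓ → RowPivotable Q i ℓ →
         RowStep i (Q , V) (addRow ℓ i Q , addRow ℓ i V)

RowDone : ∀ {n} → Fin n → State n → Set
RowDone i s = ∀ ℓ → ¬ RowPivotable (proj₁ s) i ℓ

-- RowRuns k s s' : rows n-1, n-2, …, n-k have been processed (in this order).
data RowRuns {n} : ℕ → State n → State n → Set where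
  start : ∀ {s} → RowRuns 0 s s
  next  : ∀ {k s s' s''} → RowRuns k s s' → (i : Fin n) → toℕ i + suc k ≡ n →
          Star (RowStep i) s' s'' → RowDone i s'' → RowRuns (suc k) s s''

ExhaustiveRowReduction : ∀ {n} → PolyhedralComplex n → Mat n → Mat n → Set
ExhaustiveRowReduction {n} K Q V = RowRuns n (boundary K , Id) (Q , V)

InA-low : ∀ {n} → PolyhedralComplex n → Mat n → ℤ → Fin n → Set
InA-low K R p j = PolyhedralComplex.dim K j ≡ p × ∃ λ r → R r j ≡ true

InA-up : ∀ {n} → PolyhedralComplex n → Mat n → ℤ → Fin n → Set
InA-up K Q p i = PolyhedralComplex.dim K i ≡ p × ∃ λ c → Q i c ≡ true

{-# OPTIONS --safe #-}
module Submission where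

-- Off the diagonal, U and V only receive entries copied from a pivot.  Adding column ℓ
-- to column j copies column ℓ of U into column j, so a 1 at U[i,c] with i ≠ c means that
-- column i was an earlier pivot, hence non-zero in R; later steps only touch later columns,
-- so it stays non-zero.  Dually, V[a,b] = 1 with a ≠ b means that row b of Q is an already
-- processed pivot row, never touched again.  Row additions only combine rows sharing a
-- pivot column and Q stays graded by dimension like ∂, so V only relates cells of equal
-- dimension, and q = dim σ_i works.

open import Defs
open import Algebra.Bundles using (AbelianGroup)
open import Data.Bool using (true; false; _xor_)
open import Data.Fin using (Fin; toℕ; _≟_)
open import Data.Fin.Properties using (<⇒≢)
open import Data.Integer as ℤ using (ℤ; +_; _+_)
open import Data.Integer.Properties using (+-0-abelianGroup)
open import Data.Nat as ℕ using (ℕ; suc; _≤_)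
open import Data.Nat.Properties using (m<n⇒m<1+n; n≤1+n; n<1+n; +-suc; +-monoˡ-≤; +-monoʳ-≤; +-monoʳ-<; <⇒≱; ≤-trans)
open import Data.Product using (_×_; ∃; _,_; proj₂)
open import Data.Sum as Sum using (_⊎_; inj₁; inj₂; fromInj₂)
open import Data.Empty using (⊥-elim)
open import Function using (_∘_; id)
open import Relation.Binary.Core using (Rel)
open import Relation.Binary.PropositionalEquality using (_≡_; _≢_; refl; sym; trans; cong; subst)
open import Relation.Binary.Construct.Closure.ReflexiveTransitive as Star using (Star)
open import Relation.Nullary using (yes; no)

open import Algebra.Properties.Group (AbelianGroup.group +-0-abelianGroup) using (∙-cancelʳ)

Star-preserves : ∀ {a r p} {A : Set a} {T : Rel A r} (P : A → Set p) →
                 (∀ {x y} → T x y → P x → P y) → ∀ {x y} → Star T x y → P x → P y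
Star-preserves P preserves = Star.fold (λ x y → P x → P y) (λ t f → f ∘ preserves t) id

xor-true : ∀ a b → a xor b ≡ true → a ≡ true ⊎ b ≡ true
xor-true true  _ _ = inj₁ refl
xor-true false _ h = inj₂ h

module _ {n : ℕ} where

  NonzeroColumn : Mat n → Fin n → Set
  NonzeroColumn M c = ∃ λ r → M r c ≡ true

  NonzeroRow : Mat n → Fin n → Set
  NonzeroRow M r = ∃ λ c → M r c ≡ true

  Id-true⇒≡ : ∀ {r c : Fin n} → Id r c ≡ true → r ≡ c
  Id-true⇒≡ {r} {c} h with r ≟ c
  Id-true⇒≡ h  | yes r≡c = r≡c
  Id-true⇒≡ () | no _

  addCol-true : ∀ ℓ j (M : Mat n) r c → addCol ℓ j M r c ≡ true →
                M r c ≡ true ⊎ (c ≡ j × M r ℓ ≡ true)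
  addCol-true ℓ j M r c h with c ≟ j
  ... | yes c≡j = Sum.map₂ (c≡j ,_) (xor-true (M r c) (M r ℓ) h)
  ... | no _    = inj₁ h

  addCol-≢ : ∀ ℓ {j} (M : Mat n) r {c} → c ≢ j → addCol ℓ j M r c ≡ M r c
  addCol-≢ ℓ {j} M r {c} c≢j with c ≟ j
  ... | yes c≡j = ⊥-elim (c≢j c≡j)
  ... | no _    = refl

  addRow-true : ∀ ℓ i (M : Mat n) r c → addRow ℓ i M r c ≡ true →
                M r c ≡ true ⊎ (r ≡ i × M ℓ c ≡ true)
  addRow-true ℓ i M r c h with r ≟ i
  ... | yes r≡i = Sum.map₂ (r≡i ,_) (xor-true (M r c) (M ℓ c) h)
  ... | no _    = inj₁ h

  addRow-≢ : ∀ ℓ {i} (M : Mat n) {r} c → r ≢ i → addRow ℓ i M r c ≡ M r c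
  addRow-≢ ℓ {i} M {r} c r≢i with r ≟ i
  ... | yes r≡i = ⊥-elim (r≢i r≡i)
  ... | no _    = refl

  addCol-nonzeroColumn : ∀ ℓ {j} (M : Mat n) {c} → c ≢ j →
                         NonzeroColumn M c → NonzeroColumn (addCol ℓ j M) c
  addCol-nonzeroColumn ℓ M c≢j (r , h) = r , trans (addCol-≢ ℓ M r c≢j) h

  addRow-nonzeroRow : ∀ ℓ {i} (M : Mat n) {r} → r ≢ i →
                      NonzeroRow M r → NonzeroRow (addRow ℓ i M) r
  addRow-nonzeroRow ℓ M r≢i (c , h) = c , trans (addRow-≢ ℓ M c r≢i) h

  ColRuns-induction : (P : ℕ → State n → Set) →
                      (∀ {j s s'} → ColStep j s s' → P (toℕ j) s → P (toℕ j) s') →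
                      (∀ {k s} → P k s → P (suc k) s) →
                      ∀ {k s₀ s} → ColRuns k s₀ s → P 0 s₀ → P k s
  ColRuns-induction P preserve weaken ColRuns.start              = id
  ColRuns-induction P preserve weaken (ColRuns.next runs j refl steps _) =
    weaken ∘ Star-preserves (P (toℕ j)) preserve steps ∘ ColRuns-induction P preserve weaken runs

  RowRuns-induction : (P : ℕ → State n → Set) →
                      (∀ {i k s s'} → toℕ i ℕ.+ suc k ≡ n → RowStep i s s' → P k s → P k s') →
                      (∀ {k s} → P k s → P (suc k) s) →
                      ∀ {k s₀ s} → RowRuns k s₀ s → P 0 s₀ → P k s
  RowRuns-induction P preserve weaken RowRuns.start                   = id
  RowRuns-induction P preserve weaken (RowRuns.next runs i i+1+k≡n steps _) =
    weaken ∘ Star-preserves (P _) (preserve i+1+k≡n) steps ∘ RowRuns-induction P preserve weaken runs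

  ColInvariant : ℕ → State n → Set
  ColInvariant k (R , U) =
    ∀ i c → U i c ≡ true → i ≡ c ⊎ (toℕ i ℕ.< k × NonzeroColumn R i)

  ColStep-preserves-ColInvariant : ∀ {j s s'} → ColStep j s s' →
                                   ColInvariant (toℕ j) s → ColInvariant (toℕ j) s'
  ColStep-preserves-ColInvariant {j} {R , U} (step ℓ (ℓ<j , r , (Rrℓ , _) , _)) inv i c =
    Sum.[ Sum.map₂ finished ∘ inv i c , inj₂ ∘ viaPivot ∘ inv i ℓ ∘ proj₂ ]
    ∘ addCol-true ℓ j U i c
    where
    finished : ∀ {i} → toℕ i ℕ.< toℕ j × NonzeroColumn R i →
               toℕ i ℕ.< toℕ j × NonzeroColumn (addCol ℓ j R) i
    finished (i<j , nz) = i<j , addCol-nonzeroColumn ℓ R (<⇒≢ i<j) nz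
    viaPivot : ∀ {i} → i ≡ ℓ ⊎ (toℕ i ℕ.< toℕ j × NonzeroColumn R i) →
               toℕ i ℕ.< toℕ j × NonzeroColumn (addCol ℓ j R) i
    viaPivot (inj₁ refl) = finished (ℓ<j , r , Rrℓ)
    viaPivot (inj₂ old)  = finished old

  columnReduction-invariant : ∀ {k} {M R U : Mat n} →
                              ColRuns k (M , Id) (R , U) → ColInvariant k (R , U)
  columnReduction-invariant runs =
    ColRuns-induction ColInvariant ColStep-preserves-ColInvariant weaken runs
      (λ i c → inj₁ ∘ Id-true⇒≡)
    where
    weaken : ∀ {k s} → ColInvariant k s → ColInvariant (suc k) s
    weaken inv i c = Sum.map₂ (λ (i<k , nz) → m<n⇒m<1+n i<k , nz) ∘ inv i c

module _ {n : ℕ} (dim : Fin n → ℤ) where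

  Graded : Mat n → Set
  Graded M = ∀ r c → M r c ≡ true → dim r + + 1 ≡ dim c

  addRow-graded : ∀ {ℓ i} {M : Mat n} → Graded M → dim ℓ ≡ dim i → Graded (addRow ℓ i M)
  addRow-graded {ℓ} {i} {M} graded dimℓ≡dimi r c h with addRow-true ℓ i M r c h
  ... | inj₁ Mrc          = graded r c Mrc
  ... | inj₂ (refl , Mℓc) = trans (cong (_+ + 1) (sym dimℓ≡dimi)) (graded ℓ c Mℓc)

  -- n ≤ toℕ b + k says that row b is among the last k rows, i.e. already processed.
  RowInvariant : ℕ → State n → Set
  RowInvariant k (Q , V) = Graded Q ×
    (∀ a b → V a b ≡ true → a ≡ b ⊎ (dim a ≡ dim b × n ≤ toℕ b ℕ.+ k × NonzeroRow Q b))

  RowStep-preserves-RowInvariant : ∀ {i k s s'} → toℕ i ℕ.+ suc k ≡ n → RowStep i s s' →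
                                   RowInvariant k s → RowInvariant k s'
  RowStep-preserves-RowInvariant {i} {k} {Q , V} i+1+k≡n
    (step ℓ (i<ℓ , c , (Qℓc , _) , Qic)) (graded , inv) =
    addRow-graded graded dimℓ≡dimi ,
    λ a b → Sum.[ Sum.map₂ finished ∘ inv a b , viaPivot ] ∘ addRow-true ℓ i V a b
    where
    dimℓ≡dimi : dim ℓ ≡ dim i
    dimℓ≡dimi = ∙-cancelʳ (+ 1) (dim ℓ) (dim i) (trans (graded ℓ c Qℓc) (sym (graded i c Qic)))

    processed⇒≢i : ∀ {b} → n ≤ toℕ b ℕ.+ k → b ≢ i
    processed⇒≢i {b} n≤b+k refl =
      <⇒≱ (+-monoʳ-< (toℕ b) (n<1+n k)) (subst (_≤ toℕ b ℕ.+ k) (sym i+1+k≡n) n≤b+k)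

    ℓ-processed : n ≤ toℕ ℓ ℕ.+ k
    ℓ-processed = subst (_≤ toℕ ℓ ℕ.+ k) (trans (sym (+-suc (toℕ i) k)) i+1+k≡n) (+-monoˡ-≤ k i<ℓ)

    finished : ∀ {a b} → dim a ≡ dim b × n ≤ toℕ b ℕ.+ k × NonzeroRow Q b →
               dim a ≡ dim b × n ≤ toℕ b ℕ.+ k × NonzeroRow (addRow ℓ i Q) b
    finished (d , n≤b+k , nz) = d , n≤b+k , addRow-nonzeroRow ℓ Q (processed⇒≢i n≤b+k) nz

    viaPivot : ∀ {a b} → a ≡ i × V ℓ b ≡ true →
               a ≡ b ⊎ (dim a ≡ dim b × n ≤ toℕ b ℕ.+ k × NonzeroRow (addRow ℓ i Q) b)
    viaPivot {b = b} (refl , Vℓb) with inv ℓ b Vℓb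
    ... | inj₁ refl      = inj₂ (finished (sym dimℓ≡dimi , ℓ-processed , c , Qℓc))
    ... | inj₂ (d , old)    = inj₂ (finished (trans (sym dimℓ≡dimi) d , old))

  rowReduction-invariant : ∀ {k} {M Q V : Mat n} → Graded M →
                           RowRuns k (M , Id) (Q , V) → RowInvariant k (Q , V)
  rowReduction-invariant graded runs =
    RowRuns-induction RowInvariant RowStep-preserves-RowInvariant weaken runs
      (graded , λ a b → inj₁ ∘ Id-true⇒≡)
    where
    weaken : ∀ {k s} → RowInvariant k s → RowInvariant (suc k) s
    weaken {k} (graded , inv) = graded , λ a b → Sum.map₂
      (λ (d , n≤b+k , nz) → d , ≤-trans n≤b+k (+-monoʳ-≤ (toℕ b) (n≤1+n k)) , nz) ∘ inv a b

module _ {n : ℕ} (K : PolyhedralComplex n) where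
  open PolyhedralComplex K

  boundary-graded : Graded dim (boundary K)
  boundary-graded r c h with r ≼? c | dim r + + 1 ℤ.≟ dim c
  ... | _ | yes e = e
  boundary-graded r c () | yes _ | no _
  boundary-graded r c () | no _  | no _

lemma1 : ∀ {n} (K : PolyhedralComplex n) → Monotonic K →
         ∀ (R U Q V : Mat n) →
         ExhaustiveColumnReduction K R U →
         ExhaustiveRowReduction K Q V →
         ∀ (i j : Fin n) → i ≢ j →
         ∃ λ (q : ℤ) → (U i j ≡ true → InA-low K R q i)
                     × (V i j ≡ true → InA-up K Q q j)
lemma1 K _ R U Q V columnReduction rowReduction i j i≢j = dim i , columnNonzero , rowNonzero
  where
  open PolyhedralComplex K using (dim)

  offDiagonal : ∀ {A : Set} → i ≡ j ⊎ A → A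
  offDiagonal = fromInj₂ (⊥-elim ∘ i≢j)

  columnNonzero : U i j ≡ true → InA-low K R (dim i) i
  columnNonzero Uij = refl , proj₂ (offDiagonal (columnReduction-invariant columnReduction i j Uij))

  rowNonzero : V i j ≡ true → InA-up K Q (dim i) j
  rowNonzero Vij with offDiagonal (proj₂ (rowReduction-invariant dim (boundary-graded K) rowReduction) i j Vij)
  ... | dimi≡dimj , _ , nz = sym dimi≡dimj , nz
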